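{- Let $t,n\ge1$, $p\ge t+2$, fix $g\in\{1,\ldots,n\}$ and a cluster $A_0$ of grading $(g-1,\ldots,g-1)$. Let $a,b,c\in\mathfrak{P}$ be pairwise distinct posts and fix $v\in\{1,\ldots,t\}$. Let $\mathbf{g}_v=(g_1,\ldots,g_t)$ with $g_v=g$ and $g_u=g-1$ for $u\ne v$, and let $A,B,C\subseteq A_0$ be the clusters of grading $\mathbf{g}_v$ contained in $A_0$ in which the disk $d_{v,g}$ occupies post $a$, $b$, $c$ respectively. Let $\alpha\in A$ be a configuration with $\rho^g_{b,c}(\alpha)=\alpha$, and let $\beta\in B$ be a configuration. Let $\nu$ be a valid configuration sequence from $\alpha$ to $\beta$ which is a concatenation $\nu=\nu_A+\nu_C+\nu_B$ of nonempty sequences $\nu_A,\nu_C,\nu_B$ whose configurations all lie in $A$, $C$, $B$ respectively. Then there exists a valid configuration sequence $\mu$ from $\alpha$ to $\beta$ which is a concatenation $\mu=\mu_A+\mu_B$ with all configurations of $\mu_A$ in $A$ and all configurations of $\mu_B$ in $B$, such that the transfer length of $\mu$ is strictly less than the transfer length of $\nu$.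
   Context: Setting (parallel Tower of Hanoi): there are $t$ towers (colors) of $n$ disks each and $p\ge t+2$ posts forming a set $\mathfrak{P}$. Disk $d_{u,j}$ ($u\in\{1,\ldots,t\}$, $j\in\{1,\ldots,n\}$) is the $j$-th largest disk of color $u$; smaller index means larger disk, and disks of the same index have equal size. A configuration is a $t\times n$ matrix $(a_{u,j})$ with entries in $\mathfrak{P}$, where $a_{u,j}$ is the post occupied by $d_{u,j}$, such that for each $j$ the entries $a_{1,j},\ldots,a_{t,j}$ are pairwise distinct (no disk on a smaller or equal-sized disk; disks on a post are stacked by size). Configurations $\alpha=(a_{u,j})$ and $\beta=(b_{u,j})$ are EREW-adjacent if (i) $a_{u,j}\ne b_{u,j}$ for at least one $(u,j)$, and (ii) whenever $a_{u,j}\ne b_{u,j}$, for all $w\in\{1,\ldots,t\}$ and all $y>j$ we have $a_{w,y}\ne a_{u,j}$ and $b_{w,y}\ne b_{u,j}$. A valid configuration sequence is a finite sequence $(\alpha_1,\ldots,\alpha_m)$ in which each consecutive pair is either equal or EREW-adjacent; "$+$" denotes concatenation of sequences. For configurations let $e(\alpha,\beta)$ be the number of disks $d_{u,j}$ with $a_{u,j}\ne b_{u,j}$; the transfer length of $(\alpha_1,\ldots,\alpha_m)$ is $\sum_{1\le i<m} e(\alpha_i,\alpha_{i+1})$. For $\mathbf{g}=(g_1,\ldots,g_t)\in\{0,\ldots,n\}^t$, a cluster of grading $\mathbf{g}$ is the set of all configurations in which, for each $u$, the disks $d_{u,1},\ldots,d_{u,g_u}$ occupy prescribed fixed posts (grading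 $(0,\ldots,0)$ gives all configurations). Reflective map: for $g\in\{1,\ldots,n\}$ and posts $q,r$, $\rho^g_{q,r}$ sends $(a_{u,y})$ to $(b_{u,y})$ where $b_{u,y}=a_{u,y}$ for $y<g$, and for $y\ge g$: $b_{u,y}=r$ if $a_{u,y}=q$, $b_{u,y}=q$ if $a_{u,y}=r$, and $b_{u,y}=a_{u,y}$ otherwise. -}

module Defs where

open import Data.Nat using (ℕ; zero; suc; _+_; _<_; _≤_; _<?_)
open import Data.Fin using (Fin; toℕ)
open import Data.Fin.Properties using (_≟_)
open import Data.List using (List; []; _∷_; map; allFin)
open import Data.Nat.ListAction using (sum)
open import Data.List.Relation.Unary.All using (All)
open import Data.Product using (Σ; _×_; ∃-syntax)
open import Data.Sum using (_⊎_)
open import Data.Unit using (⊤)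
open import Data.Bool using (if_then_else_)
open import Relation.Nullary using (¬_; does)
open import Relation.Binary.PropositionalEquality using (_≡_; _≢_)

-- Conventions: colors are Fin t, posts are Fin p, disk indices are Fin n,
-- 0-indexed: index j : Fin n stands for the paper's index j+1
-- (smaller index = larger disk).

Matrix : ℕ → ℕ → ℕ → Set
Matrix t n p = Fin t → Fin n → Fin p

record Config (t n p : ℕ) : Set where
  constructor config
  field
    pos      : Matrix t n p
    distinct : ∀ (j : Fin n) {u w : Fin t} → u ≢ w → pos u j ≢ pos w j
open Config public

module _ {t n p : ℕ} where

  SameConfig : Config t n p → Config t n p → Set
  SameConfig α β = ∀ u j → pos α u j ≡ pos β u j

  EREWAdjacent : Config t n p → Config t n p → Set
  EREWAdjacent α β =
    (Σ (Fin t) λ u → Σ (Fin n) λ j → pos α u j ≢ pos β u j)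
    × (∀ (u : Fin t) (j : Fin n) → pos α u j ≢ pos β u j →
         ∀ (w : Fin t) (y : Fin n) → toℕ j < toℕ y →
           (pos α w y ≢ pos α u j) × (pos β w y ≢ pos β u j))

  ValidStep : Config t n p → Config t n p → Set
  ValidStep α β = SameConfig α β ⊎ EREWAdjacent α β

  Valid : List (Config t n p) → Set
  Valid []           = ⊤
  Valid (_ ∷ [])     = ⊤
  Valid (x ∷ y ∷ xs) = ValidStep x y × Valid (y ∷ xs)

  e : Config t n p → Config t n p → ℕ
  e α β = sum (map (λ u → sum (map (λ j →
            if does (pos α u j ≟ pos β u j) then 0 else 1) (allFin n))) (allFin t))

  transferLength : List (Config t n p) → ℕ
  transferLength []           = 0
  transferLength (_ ∷ [])     = 0
  transferLength (x ∷ y ∷ xs) = e x y + transferLength (y ∷ xs)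

  -- Cluster A₀ of grading (g-1,…,g-1), where g = toℕ k + 1 (k : Fin n is the
  -- 0-indexed position of the paper's index g): disks with 0-indexed
  -- index j < k occupy the prescribed posts π u j.
  InA₀ : (k : Fin n) (π : Matrix t n p) → Config t n p → Set
  InA₀ k π α = ∀ (u : Fin t) (j : Fin n) → toℕ j < toℕ k → pos α u j ≡ π u j

  -- The sub-cluster of A₀ of grading g_v in which d_{v,g} lies on post q.
  InSub : (k : Fin n) (π : Matrix t n p) (v : Fin t) (q : Fin p) → Config t n p → Set
  InSub k π v q α = InA₀ k π α × (pos α v k ≡ q)

  ρ : (k : Fin n) (q r : Fin p) → Matrix t n p → Matrix t n p
  ρ k q r a u y =
    if does (toℕ y <? toℕ k) then a u y
    else (if does (a u y ≟ q) then r else (if does (a u y ≟ r) then q else a u y))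

-- Apply the reflection ρ^g_{b,c} to every configuration of ν before it enters
-- B.  Inside A₀ it moves nothing below index g and applies one transposition
-- of b and c to all disks at or above g, so it keeps steps valid without
-- lengthening them; it maps A into A and C onto B, and fixes α.  The single
-- step of ν from C into B moves d_{v,g} from c to b.  After reflecting,
-- d_{v,g} is already on b, while a disk at index ≥ g that did not move can be
-- on neither b nor c (those posts are cleared by the move of d_{v,g}), so it
-- still does not move: that step stays valid and becomes strictly shorter.
module Submission where

open import Defs
open import Data.Nat using (ℕ; _+_; _<_; _≤_; _<?_; z≤n; s≤s)
open import Data.Nat.Properties
  using (≤-refl; ≤-trans; <⇒≤; ≤⇒≯; ≮⇒≥; ≤-<-trans; m≤n⇒m<n∨m≡n;
         +-mono-≤; +-mono-≤-<; +-mono-<-≤; +-monoˡ-≤; +-monoˡ-<)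
open import Data.Nat.ListAction using (sum)
open import Data.Fin using (Fin; toℕ)
open import Data.Fin.Properties using (_≟_; all?; ¬∀⟶∃¬; toℕ-injective)
open import Data.List using (List; []; _∷_; _++_; head; last; map; allFin)
open import Data.List.Properties using (++-assoc)
open import Data.List.Relation.Unary.All using (All; []; _∷_)
import Data.List.Relation.Unary.All as All
open import Data.List.Relation.Unary.All.Properties using (++⁺; map⁺)
open import Data.List.Relation.Unary.Any using (here; there)
open import Data.List.Membership.Propositional using (_∈_)
open import Data.List.Membership.Propositional.Properties using (∈-allFin)
open import Data.Maybe using (just)
open import Data.Product using (_×_; ∃-syntax; _,_; proj₁; proj₂)
open import Data.Sum using (inj₁; inj₂)
open import Data.Bool using (if_then_else_)
open import Function using (_∘_)
open import Relation.Nullary using (yes; no; does; contradiction)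
open import Relation.Nullary.Decidable using (dec-true; dec-false)
open import Relation.Binary.PropositionalEquality using (_≡_; _≢_; refl; sym; trans; cong)

sum-map-mono-≤ : {A : Set} {f g : A → ℕ} → (∀ x → f x ≤ g x) →
  ∀ xs → sum (map f xs) ≤ sum (map g xs)
sum-map-mono-≤ f≤g []       = z≤n
sum-map-mono-≤ f≤g (x ∷ xs) = +-mono-≤ (f≤g x) (sum-map-mono-≤ f≤g xs)

sum-map-mono-< : {A : Set} {f g : A → ℕ} → (∀ x → f x ≤ g x) →
  ∀ {x₀ xs} → x₀ ∈ xs → f x₀ < g x₀ → sum (map f xs) < sum (map g xs)
sum-map-mono-< f≤g {xs = _ ∷ xs} (here refl) f<g  = +-mono-<-≤ f<g (sum-map-mono-≤ f≤g xs)
sum-map-mono-< f≤g {xs = x ∷ _}  (there x₀∈xs) f<g = +-mono-≤-< (f≤g x) (sum-map-mono-< f≤g x₀∈xs f<g)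

last-++-∷ : {A : Set} (xs : List A) (y : A) (ys : List A) → last (xs ++ y ∷ ys) ≡ last (y ∷ ys)
last-++-∷ []           y ys = refl
last-++-∷ (_ ∷ [])     y ys = refl
last-++-∷ (_ ∷ x ∷ xs) y ys = last-++-∷ (x ∷ xs) y ys

mismatch : {p : ℕ} → Fin p → Fin p → ℕ
mismatch x y = if does (x ≟ y) then 0 else 1

mismatch-mono : {p : ℕ} {x y x′ y′ : Fin p} → (x ≡ y → x′ ≡ y′) → mismatch x′ y′ ≤ mismatch x y
mismatch-mono {x = x} {y} {x′} {y′} agree with x ≟ y | x′ ≟ y′
... | yes x≡y | no x′≢y′ = contradiction (agree x≡y) x′≢y′
... | yes _   | yes _    = z≤n
... | no _    | yes _    = z≤n
... | no _    | no _     = ≤-refl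

mismatch-< : {p : ℕ} {x y x′ y′ : Fin p} → x ≢ y → x′ ≡ y′ → mismatch x′ y′ < mismatch x y
mismatch-< {x = x} {y} {x′} {y′} x≢y x′≡y′ with x ≟ y | x′ ≟ y′
... | yes x≡y | _        = contradiction x≡y x≢y
... | no _    | no x′≢y′ = contradiction x′≡y′ x′≢y′
... | no _    | yes _    = s≤s z≤n

module _ {t n p : ℕ} where

  Agreement⊆ : (α β α′ β′ : Config t n p) → Set
  Agreement⊆ α β α′ β′ = ∀ u j → pos α u j ≡ pos β u j → pos α′ u j ≡ pos β′ u j

  e-mono : {α β α′ β′ : Config t n p} → Agreement⊆ α β α′ β′ → e α′ β′ ≤ e α β
  e-mono agree =
    sum-map-mono-≤ (λ u → sum-map-mono-≤ (λ j → mismatch-mono (agree u j)) (allFin n)) (allFin t)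

  e-mono-< : {α β α′ β′ : Config t n p} → Agreement⊆ α β α′ β′ → ∀ u j →
    pos α u j ≢ pos β u j → pos α′ u j ≡ pos β′ u j → e α′ β′ < e α β
  e-mono-< agree u j moved fixed =
    sum-map-mono-< (λ w → sum-map-mono-≤ (λ i → mismatch-mono (agree w i)) (allFin n)) (∈-allFin u)
      (sum-map-mono-< (λ i → mismatch-mono (agree u i)) (∈-allFin j) (mismatch-< moved fixed))

  -- Condition (ii) of EREW-adjacency; ValidStep is equivalent to it, since
  -- condition (i) fails exactly when the configurations are equal.
  OnlyTopDisksMove : Config t n p → Config t n p → Set
  OnlyTopDisksMove α β = ∀ u j → pos α u j ≢ pos β u j → ∀ w y → toℕ j < toℕ y →
    (pos α w y ≢ pos α u j) × (pos β w y ≢ pos β u j)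

  validStep⇒onlyTopDisksMove : {α β : Config t n p} → ValidStep α β → OnlyTopDisksMove α β
  validStep⇒onlyTopDisksMove (inj₁ same)    u j moved = contradiction (same u j) moved
  validStep⇒onlyTopDisksMove (inj₂ (_ , top))       = top

  onlyTopDisksMove⇒validStep : {α β : Config t n p} → OnlyTopDisksMove α β → ValidStep α β
  onlyTopDisksMove⇒validStep {α} {β} top with all? (λ u → all? (λ j → pos α u j ≟ pos β u j))
  ... | yes same = inj₁ same
  ... | no different with ¬∀⟶∃¬ t _ (λ u → all? (λ j → pos α u j ≟ pos β u j)) different
  ... | u , u-moves with ¬∀⟶∃¬ n _ (λ j → pos α u j ≟ pos β u j) u-moves
  ... | j , moved = inj₂ ((u , j , moved) , top)

  validStep-respˡ : {α α′ β : Config t n p} → SameConfig α α′ → ValidStep α β → ValidStep α′ β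
  validStep-respˡ {α} {α′} {β} same step = onlyTopDisksMove⇒validStep {α = α′} {β} top′
    where
    top : OnlyTopDisksMove α β
    top = validStep⇒onlyTopDisksMove {α = α} {β} step
    top′ : OnlyTopDisksMove α′ β
    top′ u j moved w y j<y =
      (λ eq → proj₁ above (trans (same w y) (trans eq (sym (same u j))))) , proj₂ above
      where above = top u j (moved ∘ trans (sym (same u j))) w y j<y

  Valid-tail : ∀ {α} {αs : List (Config t n p)} → Valid (α ∷ αs) → Valid αs
  Valid-tail {αs = []}    _       = _
  Valid-tail {αs = _ ∷ _} (_ , v) = v

  Valid-++⁻ʳ : ∀ (αs : List (Config t n p)) {βs} → Valid (αs ++ βs) → Valid βs
  Valid-++⁻ʳ []       v = v
  Valid-++⁻ʳ (_ ∷ αs) v = Valid-++⁻ʳ αs (Valid-tail v)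

  record Shortcut (μ ν : List (Config t n p)) : Set where
    constructor _,_
    field
      valid   : Valid μ
      shorter : transferLength μ < transferLength ν

  shortcut-replaceHead : ∀ {α α′} {μ ν : List (Config t n p)} → SameConfig α α′ →
    Shortcut (α ∷ μ) ν → Shortcut (α′ ∷ μ) ν
  shortcut-replaceHead {μ = []}    same (_ , shorter) = _ , shorter
  shortcut-replaceHead {α} {α′} {γ ∷ μ} same ((step , valid) , shorter) =
    (validStep-respˡ {α = α} {α′} {γ} same step , valid) ,
    ≤-<-trans (+-monoˡ-≤ (transferLength (γ ∷ μ)) e-head) shorter
    where
    e-head : e α′ γ ≤ e α γ
    e-head = e-mono {α = α} {γ} {α′} {γ} (λ u j → trans (sym (same u j)))

  movedDisk-index-≥ : ∀ {k : Fin n} {π} (α β : Config t n p) {u j} → InA₀ k π α → InA₀ k π β →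
    pos α u j ≢ pos β u j → toℕ k ≤ toℕ j
  movedDisk-index-≥ α β {u} {j} inα inβ moved =
    ≮⇒≥ (λ j<k → moved (trans (inα u j j<k) (sym (inβ u j j<k))))

  alone-on-post : (α : Config t n p) (v : Fin t) (k : Fin n) →
    (∀ w y → toℕ k < toℕ y → pos α w y ≢ pos α v k) →
    ∀ {u j} → toℕ k ≤ toℕ j → pos α u j ≡ pos α v k → u ≡ v × j ≡ k
  alone-on-post α v k clear {u} {j} k≤j eq with m≤n⇒m<n∨m≡n k≤j
  ... | inj₁ k<j = contradiction eq (clear u j k<j)
  ... | inj₂ k≡j with toℕ-injective k≡j
  ...   | refl with u ≟ v
  ...     | yes u≡v = u≡v , refl
  ...     | no u≢v  = contradiction eq (distinct α k u≢v)

module _ {p : ℕ} (q r : Fin p) where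

  swap : Fin p → Fin p
  swap z = if does (z ≟ q) then r else (if does (z ≟ r) then q else z)

  swap-q : swap q ≡ r
  swap-q rewrite dec-true (q ≟ q) refl = refl

  swap-r : swap r ≡ q
  swap-r with r ≟ q
  ... | yes r≡q = r≡q
  ... | no _ rewrite dec-true (r ≟ r) refl = refl

  swap-other : ∀ {z} → z ≢ q → z ≢ r → swap z ≡ z
  swap-other {z} z≢q z≢r rewrite dec-false (z ≟ q) z≢q | dec-false (z ≟ r) z≢r = refl

  swap-involutive : ∀ z → swap (swap z) ≡ z
  swap-involutive z with z ≟ q
  ... | yes refl = swap-r
  ... | no z≢q with z ≟ r
  ...   | yes refl = swap-q
  ...   | no z≢r   = swap-other z≢q z≢r

  swap-injective : ∀ {x y} → swap x ≡ swap y → x ≡ y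
  swap-injective {x} {y} eq =
    trans (sym (swap-involutive x)) (trans (cong swap eq) (swap-involutive y))

module _ {n p : ℕ} (k : Fin n) (q r : Fin p) where

  reflectPost : Fin n → Fin p → Fin p
  reflectPost y z = if does (toℕ y <? toℕ k) then z else swap q r z

  reflectPost-below : ∀ {y z} → toℕ y < toℕ k → reflectPost y z ≡ z
  reflectPost-below {y} y<k rewrite dec-true (toℕ y <? toℕ k) y<k = refl

  reflectPost-above : ∀ {y z} → toℕ k ≤ toℕ y → reflectPost y z ≡ swap q r z
  reflectPost-above {y} k≤y rewrite dec-false (toℕ y <? toℕ k) (≤⇒≯ k≤y) = refl

  reflectPost-cancel-above : ∀ {y j z z′} → toℕ k ≤ toℕ y → toℕ k ≤ toℕ j →
    reflectPost y z ≡ reflectPost j z′ → z ≡ z′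
  reflectPost-cancel-above k≤y k≤j eq =
    swap-injective q r (trans (sym (reflectPost-above k≤y)) (trans eq (reflectPost-above k≤j)))

  reflectPost-injective : ∀ y {z z′} → reflectPost y z ≡ reflectPost y z′ → z ≡ z′
  reflectPost-injective y eq with toℕ y <? toℕ k
  ... | yes y<k = trans (sym (reflectPost-below y<k)) (trans eq (reflectPost-below y<k))
  ... | no y≮k  = reflectPost-cancel-above (≮⇒≥ y≮k) (≮⇒≥ y≮k) eq

module _ {t n p : ℕ} (k : Fin n) (q r : Fin p) where

  reflect : Config t n p → Config t n p
  reflect α = config (ρ k q r (pos α))
    (λ j u≢w same → distinct α j u≢w (reflectPost-injective k q r j same))

  reflect-e : (α β : Config t n p) → e (reflect α) (reflect β) ≤ e α β
  reflect-e α β = e-mono {α = α} {β} {reflect α} {reflect β} (λ u j → cong (reflectPost k q r j))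

  reflect-InA₀ : ∀ {π α} → InA₀ k π α → InA₀ k π (reflect α)
  reflect-InA₀ inα u j j<k = trans (reflectPost-below k q r j<k) (inα u j j<k)

  reflect-InSub : ∀ {π v s s′ α} → swap q r s ≡ s′ → InSub k π v s α → InSub k π v s′ (reflect α)
  reflect-InSub {π} {α = α} swapped (inα , onS) =
    reflect-InA₀ {π} {α} inα ,
    trans (reflectPost-above k q r ≤-refl) (trans (cong (swap q r) onS) swapped)

  reflect-validStep : ∀ {π} {α β : Config t n p} → InA₀ k π α → InA₀ k π β →
    ValidStep α β → ValidStep (reflect α) (reflect β)
  reflect-validStep {α = α} {β} inα inβ step =
    onlyTopDisksMove⇒validStep {α = reflect α} {reflect β} top′
    where
    top : OnlyTopDisksMove α β
    top = validStep⇒onlyTopDisksMove {α = α} {β} step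
    top′ : OnlyTopDisksMove (reflect α) (reflect β)
    top′ u j moved w y j<y =
      proj₁ above ∘ cancel , proj₂ above ∘ cancel
      where
      moved₀ = moved ∘ cong (reflectPost k q r j)
      k≤j = movedDisk-index-≥ α β inα inβ moved₀
      above = top u j moved₀ w y j<y
      cancel : ∀ {z z′} → reflectPost k q r y z ≡ reflectPost k q r j z′ → z ≡ z′
      cancel = reflectPost-cancel-above k q r (≤-trans k≤j (<⇒≤ j<y)) k≤j

module Detour {t n p : ℕ} (k : Fin n) (π : Matrix t n p) (b c : Fin p) (b≢c : b ≢ c) (v : Fin t) where

  R : Config t n p → Config t n p
  R = reflect k b c

  A₀ : Config t n p → Set
  A₀ = InA₀ k π

  module Crossing {γ z : Config t n p} (inγ : InSub k π v c γ) (inz : InSub k π v b z)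
                  (step : ValidStep γ z) where

    top : OnlyTopDisksMove γ z
    top = validStep⇒onlyTopDisksMove {α = γ} {z} step

    γ-moves : pos γ v k ≢ pos z v k
    γ-moves eq = b≢c (trans (sym (proj₂ inz)) (trans (sym eq) (proj₂ inγ)))

    moves-at-v : ∀ {u j} → u ≡ v × j ≡ k → pos γ u j ≢ pos z u j
    moves-at-v (refl , refl) = γ-moves

    shared-avoids-b : ∀ {u j} → toℕ k ≤ toℕ j → pos γ u j ≡ pos z u j → pos γ u j ≢ b
    shared-avoids-b k≤j shared onB = moves-at-v
      (alone-on-post z v k (λ w y k<y → proj₂ (top v k γ-moves w y k<y)) k≤j
        (trans (sym shared) (trans onB (sym (proj₂ inz))))) shared

    shared-avoids-c : ∀ {u j} → toℕ k ≤ toℕ j → pos γ u j ≡ pos z u j → pos γ u j ≢ c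
    shared-avoids-c k≤j shared onC = moves-at-v
      (alone-on-post γ v k (λ w y k<y → proj₁ (top v k γ-moves w y k<y)) k≤j
        (trans onC (sym (proj₂ inγ)))) shared

    reflect-keeps-shared : Agreement⊆ γ z (R γ) z
    reflect-keeps-shared u j shared with toℕ j <? toℕ k
    ... | yes j<k = trans (reflectPost-below k b c j<k) shared
    ... | no j≮k  = trans (reflectPost-above k b c k≤j) (trans (swap-other b c avoids-b avoids-c) shared)
      where
      k≤j = ≮⇒≥ j≮k
      avoids-b = shared-avoids-b k≤j shared
      avoids-c = shared-avoids-c k≤j shared

    reflected-validStep : ValidStep (R γ) z
    reflected-validStep = onlyTopDisksMove⇒validStep {α = R γ} {z} top′
      where
      top′ : OnlyTopDisksMove (R γ) z
      top′ u j moved w y j<y =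
        proj₁ above ∘ reflectPost-cancel-above k b c (≤-trans k≤j (<⇒≤ j<y)) k≤j , proj₂ above
        where
        moved₀ = moved ∘ reflect-keeps-shared u j
        k≤j = movedDisk-index-≥ γ z (proj₁ inγ) (proj₁ inz) moved₀
        above = top u j moved₀ w y j<y

    e-decreases : e (R γ) z < e γ z
    e-decreases = e-mono-< {α = γ} {z} {R γ} {z} reflect-keeps-shared v k γ-moves
      (trans (reflectPost-above k b c ≤-refl)
        (trans (cong (swap b c) (proj₂ inγ)) (trans (swap-r b c) (sym (proj₂ inz)))))

  shortcut-crossing : ∀ {γ z} {zs : List (Config t n p)} → InSub k π v c γ → InSub k π v b z →
    ValidStep γ z → Valid (z ∷ zs) → Shortcut (R γ ∷ z ∷ zs) (γ ∷ z ∷ zs)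
  shortcut-crossing {γ} {z} {zs} inγ inz step valid =
    (reflected-validStep , valid) , +-monoˡ-< (transferLength (_ ∷ zs)) e-decreases
    where open Crossing {γ} {z} inγ inz step

  shortcut-∷-reflected : ∀ {x y} {μ ν : List (Config t n p)} → A₀ x → A₀ y → ValidStep x y →
    Shortcut (R y ∷ μ) (y ∷ ν) → Shortcut (R x ∷ R y ∷ μ) (x ∷ y ∷ ν)
  shortcut-∷-reflected {x} {y} inx iny step (valid , shorter) =
    (reflect-validStep k b c {π} {x} {y} inx iny step , valid) , +-mono-≤-< (reflect-e k b c x y) shorter

  shortcut-reflect-C : ∀ γ γs z zs → All (InSub k π v c) (γ ∷ γs) → InSub k π v b z →
    Valid (γ ∷ γs ++ z ∷ zs) → Shortcut (R γ ∷ map R γs ++ z ∷ zs) (γ ∷ γs ++ z ∷ zs)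
  shortcut-reflect-C γ []        z zs (inγ ∷ [])  inz (step , valid) =
    shortcut-crossing inγ inz step valid
  shortcut-reflect-C γ (γ′ ∷ γs) z zs (inγ ∷ inγs) inz (step , valid) =
    shortcut-∷-reflected (proj₁ inγ) (proj₁ (All.head inγs)) step
      (shortcut-reflect-C γ′ γs z zs inγs inz valid)

  shortcut-reflect-A₀ : ∀ x xs y μ ν → All A₀ (x ∷ xs) → A₀ y → Valid (x ∷ xs ++ y ∷ ν) →
    Shortcut (R y ∷ μ) (y ∷ ν) → Shortcut (R x ∷ map R xs ++ R y ∷ μ) (x ∷ xs ++ y ∷ ν)
  shortcut-reflect-A₀ x []        y μ ν (inx ∷ [])  iny (step , _)     shortcut =
    shortcut-∷-reflected inx iny step shortcut
  shortcut-reflect-A₀ x (x′ ∷ xs) y μ ν (inx ∷ inxs) iny (step , valid) shortcut =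
    shortcut-∷-reflected inx (All.head inxs) step
      (shortcut-reflect-A₀ x′ xs y μ ν inxs iny valid shortcut)

theorem2 : (t n p : ℕ) → 1 ≤ t → 1 ≤ n → t + 2 ≤ p →
    (k : Fin n) (π : Matrix t n p) (a b c : Fin p) → a ≢ b → b ≢ c → a ≢ c →
    (v : Fin t) (α β : Config t n p) →
    InSub k π v a α → (∀ u y → ρ k b c (pos α) u y ≡ pos α u y) →
    InSub k π v b β →
    (νA νC νB : List (Config t n p)) →
    (∃[ x ] ∃[ xs ] νA ≡ x ∷ xs) → (∃[ x ] ∃[ xs ] νC ≡ x ∷ xs) → (∃[ x ] ∃[ xs ] νB ≡ x ∷ xs) →
    All (InSub k π v a) νA → All (InSub k π v c) νC → All (InSub k π v b) νB →
    Valid (νA ++ νC ++ νB) →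
    head (νA ++ νC ++ νB) ≡ just α → last (νA ++ νC ++ νB) ≡ just β →
    ∃[ μA ] ∃[ μB ]
      (All (InSub k π v a) μA × All (InSub k π v b) μB ×
       Valid (μA ++ μB) ×
       head (μA ++ μB) ≡ just α × last (μA ++ μB) ≡ just β ×
       transferLength (μA ++ μB) < transferLength (νA ++ νC ++ νB))
theorem2 t n p _ _ _ k π a b c a≢b b≢c a≢c v α β inα fixed _
  .(α ∷ xs) .(y ∷ ys) .(z ∷ zs) (.α , xs , refl) (y , ys , refl) (z , zs , refl)
  inA@(_ ∷ inxs) inC inB@(inz ∷ _) valid refl ν-ends-in-β =
  α ∷ map R xs , map R (y ∷ ys) ++ z ∷ zs ,
  inα ∷ map⁺ (All.map (λ {x} → reflect-InSub k b c {α = x} (swap-other b c a≢b a≢c)) inxs) ,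
  ++⁺ (map⁺ (All.map (λ {x} → reflect-InSub k b c {α = x} (swap-r b c)) inC)) inB ,
  Shortcut.valid shortcut , refl ,
  trans (ends-in-z (α ∷ map R xs) (map R (y ∷ ys)))
    (trans (sym (ends-in-z (α ∷ xs) (y ∷ ys))) ν-ends-in-β) ,
  Shortcut.shorter shortcut
  where
  open Detour k π b c b≢c v

  shortcut : Shortcut (α ∷ map R xs ++ R y ∷ map R ys ++ z ∷ zs) (α ∷ xs ++ y ∷ ys ++ z ∷ zs)
  shortcut = shortcut-replaceHead fixed
    (shortcut-reflect-A₀ α xs y _ _ (All.map proj₁ inA) (proj₁ (All.head inC)) valid
      (shortcut-reflect-C y ys z zs inC inz (Valid-++⁻ʳ (α ∷ xs) valid)))

  ends-in-z : ∀ xs ys → last (xs ++ ys ++ z ∷ zs) ≡ last (z ∷ zs)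
  ends-in-z xs ys = trans (cong last (sym (++-assoc xs ys (z ∷ zs)))) (last-++-∷ (xs ++ ys) z zs)
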